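{- Fix $\lambda\ge0$ and run the primal-dual algorithm described in the context with parameter $\bar B$. Let $T$ be the returned set of centers, $i(j)$ the point of $T$ nearest to $j$, and $S=\{j\in\mathcal D:\exists i\in T \text{ with } \beta_{ij}>0\}$. Then $$3\lambda|T|+\sum_{j\in S}f_{\bar B}(c_{i(j)j})+\sum_{j\notin S}f_{3\bar B}(c_{i(j)j})\le 3\sum_j\alpha_j.$$
   Context: Setting: $\ell$-centrum problem on a finite metric space $(\mathcal D,\{c_{ij}\})$ with $n=|\mathcal D|>k$, integers $k\ge0$, $\ell\in\{1,\dots,n\}$ (choose $k$ centers, minimize the sum of the $\ell$ largest assignment costs, optimum $\mathrm{opt}$). For $B\ge0$, $f_B(d)=d$ if $d>B/\ell$ and $0$ otherwise. $\mathrm{OPT}_B$ is the optimal value of LP (P$_B$): min $\sum_{i,j}f_B(c_{ij})x_{ij}$ s.t. $\sum_i x_{ij}\ge1$, $0\le x_{ij}\le y_i$, $\sum_iy_i\le k$. $\bar B$ is a number with $\mathrm{OPT}_{\bar B}\le\bar B\le(1+\epsilon)\mathrm{opt}$. Dual variables: $\alpha_j$ ($j\in\mathcal D$), $\beta_{ij}$ ($i,j\in\mathcal D$), with dual constraints $\alpha_j\le f_{\bar B}(c_{ij})+\beta_{ij}$, $\sum_j\beta_{ij}\le\lambda$, $\alpha,\lambda\ge0$. Algorithm for fixed $\lambda$: (1) Dual ascent: start with all clients active, $\alpha=\beta=0$, $F=\emptyset$; say $j$ reaches $i$ if $\alpha_j\ge f_{\bar B}(c_{ij})$. Until no client is active,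 raise uniformly the $\alpha_j$ of all active clients and the $\beta_{ij}$ of all pairs with $i\notin F$, $j$ active and $j$ reaching $i$, until one of these events: (a) some client $j$ newly reaches some $i\in F$: then $j$ is frozen (made inactive); (b) $\sum_j\beta_{ij}=\lambda$ for some $i\notin F$: then $i$ is added to $F$ and every active client that reaches $i$ is frozen. (2) Pruning: pick a maximal subset $T\subseteq F$ such that for every $j\in\mathcal D$ there is at most one $i\in T$ with $\beta_{ij}>0$. (3) Return $T$ as centers, assigning each client to its nearest point of $T$.
   Formalization: The costs $c_{ij}$ and the numbers $\bar B$, $\lambda$ and $\epsilon$ are rational, so the dual variables $\alpha_j$ and $\beta_{ij}$ take rational values too. -}

module Defs where

open import Data.Nat using (ℕ; zero; suc)
open import Data.Fin using (Fin; zero; suc)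
open import Data.Bool using (Bool; true; false; if_then_else_; _∧_; _∨_; not)
open import Data.Integer using (+_)
open import Data.Rational using (ℚ; 0ℚ; 1ℚ; _+_; _*_; _-_; _≤_; _<_; _⊔_; _/_)
open import Data.Rational.Properties using (_≤?_; _<?_)
open import Data.Product using (Σ; _×_; _,_; ∃; ∃-syntax)
open import Data.Sum using (_⊎_)
open import Relation.Nullary using (¬_; does)
open import Relation.Binary.PropositionalEquality using (_≡_)
open import Relation.Binary.Construct.Closure.ReflexiveTransitive using (Star)

ℕ→ℚ : ℕ → ℚ
ℕ→ℚ m = + m / 1

Σᶠ : ∀ {n} → (Fin n → ℚ) → ℚ
Σᶠ {zero}  g = 0ℚ
Σᶠ {suc n} g = g zero + Σᶠ (λ x → g (suc x))

anyᶠ : ∀ {n} → (Fin n → Bool) → Bool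
anyᶠ {zero}  p = false
anyᶠ {suc n} p = p zero ∨ anyᶠ (λ x → p (suc x))

card : ∀ {n} → (Fin n → Bool) → ℚ
card U = Σᶠ (λ x → if U x then 1ℚ else 0ℚ)

ΣIn : ∀ {n} → (Fin n → Bool) → (Fin n → ℚ) → ℚ
ΣIn U g = Σᶠ (λ x → if U x then g x else 0ℚ)

_⊆_ : ∀ {n} → (Fin n → Bool) → (Fin n → Bool) → Set
U ⊆ V = ∀ x → U x ≡ true → V x ≡ true

record IsMetric {n : ℕ} (c : Fin n → Fin n → ℚ) : Set where
  field
    nonneg : ∀ i j → 0ℚ ≤ c i j
    refl0  : ∀ i → c i i ≡ 0ℚ
    symm   : ∀ i j → c i j ≡ c j i
    tri    : ∀ i j h → c i h ≤ c i j + c j h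

-- f_B(d) = d if d > B/ℓ, and 0 otherwise.
-- (For ℓ ≥ 1, d > B/ℓ is written as B < ℓ·d.)

fB : (ℓ : ℕ) (B d : ℚ) → ℚ
fB ℓ B d = if does (B <? ℕ→ℚ ℓ * d) then d else 0ℚ

-- The LP (P_B):  OPT_B ≤ B  (optimum of an LP with rational data is
-- attained at a rational point, so this is the existence of a feasible
-- rational solution of value ≤ B).

module _ {n : ℕ} (c : Fin n → Fin n → ℚ) (k ℓ : ℕ) where

  LPFeasible : (x : Fin n → Fin n → ℚ) (y : Fin n → ℚ) → Set
  LPFeasible x y =
      (∀ j → 1ℚ ≤ Σᶠ (λ i → x i j))
    × (∀ i j → 0ℚ ≤ x i j)
    × (∀ i j → x i j ≤ y i)
    × (Σᶠ y ≤ ℕ→ℚ k)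

  LPValue : (B : ℚ) (x : Fin n → Fin n → ℚ) → ℚ
  LPValue B x = Σᶠ (λ i → Σᶠ (λ j → fB ℓ B (c i j) * x i j))

  OPT≤ : (B : ℚ) → (bound : ℚ) → Set
  OPT≤ B bound = ∃[ x ] ∃[ y ] (LPFeasible x y × LPValue B x ≤ bound)

  NearestAssignment : (C : Fin n → Bool) (a : Fin n → Fin n) → Set
  NearestAssignment C a = ∀ j → C (a j) ≡ true × (∀ i → C i ≡ true → c (a j) j ≤ c i j)

  -- B ≤ (1+ε)·opt, where opt is the minimum over sets C of k centers of the
  -- ℓ-centrum cost (sum of the ℓ largest assignment costs = maximum over
  -- ℓ-element client sets U of the total assignment cost of U).
  BoundedByOpt : (ε B : ℚ) → Set
  BoundedByOpt ε B =
    ∀ (C : Fin n → Bool) → card C ≡ ℕ→ℚ k →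
    ∀ (a : Fin n → Fin n) → NearestAssignment C a →
    ∃[ U ] (card U ≡ ℕ→ℚ ℓ × B ≤ (1ℚ + ε) * ΣIn U (λ j → c (a j) j))

record State (n : ℕ) : Set where
  constructor st
  field
    α      : Fin n → ℚ
    β      : Fin n → Fin n → ℚ
    active : Fin n → Bool
    inF    : Fin n → Bool

open State public

module Algorithm {n : ℕ} (c : Fin n → Fin n → ℚ) (ℓ : ℕ) (B̄ λ' : ℚ) where

  f : ℚ → ℚ
  f = fB ℓ B̄

  reaches : State n → Fin n → Fin n → Bool
  reaches s j i = does (f (c i j) ≤? α s j)

  pos : ℚ → ℚ
  pos q = q ⊔ 0ℚ

  initial : State n
  initial = st (λ _ → 0ℚ) (λ _ _ → 0ℚ) (λ _ → true) (λ _ → false)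

  -- the state after raising uniformly for time t ≥ 0 from s (with no event
  -- in between): α_j grows by t for active j; β_ij (i ∉ F, j active) grows
  -- at rate 1 during the part of [0,t] in which j reaches i, i.e. by
  -- max(0, α_j + t - f(c_ij)) - max(0, α_j - f(c_ij)).
  raise : State n → ℚ → State n
  raise s t = st α' β' (active s) (inF s)
    where
    α' : Fin n → ℚ
    α' j = if active s j then α s j + t else α s j
    β' : Fin n → Fin n → ℚ
    β' i j = if not (inF s i) ∧ active s j
             then β s i j + (pos (α' j - f (c i j)) - pos (α s j - f (c i j)))
             else β s i j

  Event : State n → Set
  Event s =
      (∃[ j ] ∃[ i ] (active s j ≡ true × inF s i ≡ true × reaches s j i ≡ true))
    ⊎ (∃[ i ] (inF s i ≡ false × λ' ≤ Σᶠ (λ j → β s i j)))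

  handle : State n → State n
  handle s = st (α s) (β s) act' F'
    where
    F' : Fin n → Bool
    F' i = inF s i ∨ (not (inF s i) ∧ does (λ' ≤? Σᶠ (λ j → β s i j)))
    act' : Fin n → Bool
    act' j = active s j ∧ not (anyᶠ (λ i → F' i ∧ reaches s j i))

  Step : State n → State n → Set
  Step s s' = ∃[ δ ]
      ( (∃[ j ] active s j ≡ true)
      × 0ℚ ≤ δ
      × (∀ t → 0ℚ ≤ t → t < δ → ¬ Event (raise s t))
      × Event (raise s δ)
      × s' ≡ handle (raise s δ))

  DualAscent : State n → Set
  DualAscent s = Star Step initial s × (∀ j → active s j ≡ false)

  Conflictfree : State n → (Fin n → Bool) → Set
  Conflictfree s T = ∀ j i i' → T i ≡ true → T i' ≡ true →
                     0ℚ < β s i j → 0ℚ < β s i' j → i ≡ i'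

  Pruned : State n → (Fin n → Bool) → Set
  Pruned s T = T ⊆ inF s × Conflictfree s T
             × (∀ T' → T ⊆ T' → T' ⊆ inF s → Conflictfree s T' → T' ⊆ T)

  inS : State n → (Fin n → Bool) → Fin n → Bool
  inS s T j = anyᶠ (λ i → T i ∧ does (0ℚ <? β s i j))

-- The dual ascent keeps an invariant: β_ij > 0 forces β_ij + f(c_ij) ≤ α_j, every opened i has
-- Σ_j β_ij ≥ λ, and every frozen j was frozen by an opened i₀ with f(c_{i₀j}) ≤ α_j all of whose
-- payers j' have α_{j'} ≤ α_j.  So λ|T| ≤ Σ_j Σ_{i∈T} β_ij, and it suffices to show, client by
-- client, 3 Σ_{i∈T} β_ij + cost(j) ≤ 3α_j.  A client j ∈ S pays exactly one centre i ∈ T, and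
-- 3β_ij + f(c_ij) ≤ 3α_j.  A client j ∉ S pays nothing in T; its freezing centre i₀ is in T or,
-- by maximality of T, shares a payer j' with some i' ∈ T, so the path i' – j' – i₀ – j consists of
-- three hops of f-cost at most α_j each, and then f_{3B̄}(c_{i(j)j}) ≤ 3α_j.  The invariant survives
-- raising for any time δ ≥ 0 followed by event handling, so when the events occur plays no role.
module Submission where

open import Defs
open import Data.Nat using (ℕ; _<_; _≤_)
open import Data.Fin using (Fin)
open import Data.Bool using (Bool; true; if_then_else_)
open import Data.Rational using (ℚ; 0ℚ; _+_; _*_) renaming (_≤_ to _≤ℚ_; _<_ to _<ℚ_)
open import Relation.Binary.PropositionalEquality using (_≡_)

open import Data.Nat using (zero; suc)
open import Data.Fin using (zero; suc)
open import Data.Fin.Properties using (suc-injective; any?) renaming (_≟_ to _≟ᶠ_)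
open import Data.Bool using (false; _∧_; _∨_; not)
open import Data.Bool.Properties using (∨-zeroʳ; ∧-zeroʳ; ¬-not) renaming (_≟_ to _≟ᵇ_)
open import Data.Rational using (1ℚ; _-_; -_; _⊔_)
open import Data.Rational.Properties
open import Data.Rational.Solver using (module +-*-Solver)
open import Data.Product using (∃; ∃-syntax; ∃₂; _×_; _,_; proj₁; proj₂; map₂)
open import Data.Sum using (_⊎_; inj₁; inj₂; [_,_]′)
open import Relation.Nullary using (Dec; yes; no; does; ¬_; _×-dec_; contradiction)
open import Relation.Nullary.Decidable using (dec-true; dec-false)
open import Relation.Binary.PropositionalEquality using (refl; sym; trans; cong; cong₂; subst; _≢_)
open import Function using (_∘_; id; case_of_)
open import Relation.Binary.Construct.Closure.ReflexiveTransitive using (Star; ε; _◅_)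

open +-*-Solver
open ≤-Reasoning

does-true : ∀ {A : Set} (a? : Dec A) → does a? ≡ true → A
does-true (yes a) _ = a

does-false : ∀ {A : Set} (a? : Dec A) → does a? ≡ false → ¬ A
does-false (no ¬a) _ = ¬a

∧-true : ∀ {a b} → a ∧ b ≡ true → a ≡ true × b ≡ true
∧-true {true} {true} _ = refl , refl

∨-true : ∀ {a b} → a ∨ b ≡ true → a ≡ true ⊎ b ≡ true
∨-true {true} _ = inj₁ refl
∨-true {false} b≡true = inj₂ b≡true

∧-not-true : ∀ {a b} → a ∧ not b ≡ true → b ≡ false
∧-not-true {true} {false} _ = refl

∧-not-false : ∀ {a b} → a ≡ true → a ∧ not b ≡ false → b ≡ true
∧-not-false {b = true} refl _ = refl

anyᶠ-witness : ∀ {m} (p : Fin m → Bool) → anyᶠ p ≡ true → ∃[ x ] p x ≡ true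
anyᶠ-witness {suc m} p any≡true with ∨-true {p zero} any≡true
... | inj₁ p0 = zero , p0
... | inj₂ rest = let x , px = anyᶠ-witness (λ x → p (suc x)) rest in suc x , px

anyᶠ-intro : ∀ {m} (p : Fin m → Bool) x → p x ≡ true → anyᶠ p ≡ true
anyᶠ-intro p zero px rewrite px = refl
anyᶠ-intro p (suc x) px rewrite anyᶠ-intro (λ y → p (suc y)) x px = ∨-zeroʳ (p zero)

Σᶠ-cong : ∀ {m} {g h : Fin m → ℚ} → (∀ x → g x ≡ h x) → Σᶠ g ≡ Σᶠ h
Σᶠ-cong {zero} _ = refl
Σᶠ-cong {suc m} g≡h = cong₂ _+_ (g≡h zero) (Σᶠ-cong (λ x → g≡h (suc x)))

Σᶠ-mono : ∀ {m} {g h : Fin m → ℚ} → (∀ x → g x ≤ℚ h x) → Σᶠ g ≤ℚ Σᶠ h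
Σᶠ-mono {zero} _ = ≤-refl
Σᶠ-mono {suc m} g≤h = +-mono-≤ (g≤h zero) (Σᶠ-mono (λ x → g≤h (suc x)))

Σᶠ-zero : ∀ {m} → Σᶠ {m} (λ _ → 0ℚ) ≡ 0ℚ
Σᶠ-zero {zero} = refl
Σᶠ-zero {suc m} rewrite Σᶠ-zero {m} = +-identityˡ 0ℚ

Σᶠ-nonpos : ∀ {m} {g : Fin m → ℚ} → (∀ x → g x ≤ℚ 0ℚ) → Σᶠ g ≤ℚ 0ℚ
Σᶠ-nonpos {m} g≤0 = ≤-trans (Σᶠ-mono g≤0) (≤-reflexive (Σᶠ-zero {m}))

Σᶠ-+ : ∀ {m} (g h : Fin m → ℚ) → Σᶠ (λ x → g x + h x) ≡ Σᶠ g + Σᶠ h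
Σᶠ-+ {zero} g h = sym (+-identityˡ 0ℚ)
Σᶠ-+ {suc m} g h rewrite Σᶠ-+ (λ x → g (suc x)) (λ x → h (suc x)) =
  solve 4 (λ a b c d → (a :+ b) :+ (c :+ d) := (a :+ c) :+ (b :+ d)) refl
    (g zero) (h zero) (Σᶠ (λ x → g (suc x))) (Σᶠ (λ x → h (suc x)))

Σᶠ-*ˡ : ∀ {m} (q : ℚ) (g : Fin m → ℚ) → Σᶠ (λ x → q * g x) ≡ q * Σᶠ g
Σᶠ-*ˡ {zero} q g = sym (*-zeroʳ q)
Σᶠ-*ˡ {suc m} q g rewrite Σᶠ-*ˡ q (λ x → g (suc x)) = sym (*-distribˡ-+ q (g zero) _)

Σᶠ-comm : ∀ {m p} (h : Fin m → Fin p → ℚ) →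
          Σᶠ (λ x → Σᶠ (λ y → h x y)) ≡ Σᶠ (λ y → Σᶠ (λ x → h x y))
Σᶠ-comm {zero} {p} h = sym (Σᶠ-zero {p})
Σᶠ-comm {suc m} h rewrite Σᶠ-comm (λ x → h (suc x)) = sym (Σᶠ-+ (h zero) _)

Σᶠ-≤-single : ∀ {m} (g : Fin m → ℚ) a → (∀ x → x ≢ a → g x ≤ℚ 0ℚ) → Σᶠ g ≤ℚ g a
Σᶠ-≤-single g zero others≤0 = begin
  g zero + Σᶠ (λ x → g (suc x)) ≤⟨ +-monoʳ-≤ (g zero) (Σᶠ-nonpos (λ x → others≤0 (suc x) λ ())) ⟩
  g zero + 0ℚ                   ≡⟨ +-identityʳ (g zero) ⟩
  g zero                        ∎
Σᶠ-≤-single g (suc a) others≤0 = begin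
  g zero + Σᶠ (λ x → g (suc x)) ≤⟨ +-monoˡ-≤ _ (others≤0 zero λ ()) ⟩
  0ℚ + Σᶠ (λ x → g (suc x))     ≡⟨ +-identityˡ _ ⟩
  Σᶠ (λ x → g (suc x))          ≤⟨ Σᶠ-≤-single (λ x → g (suc x)) a (λ x x≢a → others≤0 (suc x) (x≢a ∘ suc-injective)) ⟩
  g (suc a)                     ∎

ΣIn-nonpos : ∀ {m} {U : Fin m → Bool} {g : Fin m → ℚ} →
             (∀ x → U x ≡ true → g x ≤ℚ 0ℚ) → ΣIn U g ≤ℚ 0ℚ
ΣIn-nonpos {U = U} {g} g≤0 = Σᶠ-nonpos term≤0
  where
  term≤0 : ∀ x → (if U x then g x else 0ℚ) ≤ℚ 0ℚ
  term≤0 x with U x in Ux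
  ... | true = g≤0 x Ux
  ... | false = ≤-refl

ΣIn-≤-single : ∀ {m} {U : Fin m → Bool} {g : Fin m → ℚ} {a} → U a ≡ true →
               (∀ x → U x ≡ true → x ≢ a → g x ≤ℚ 0ℚ) → ΣIn U g ≤ℚ g a
ΣIn-≤-single {U = U} {g} {a} Ua others≤0 =
  subst (ΣIn U g ≤ℚ_) at-a (Σᶠ-≤-single _ a term≤0)
  where
  at-a : (if U a then g a else 0ℚ) ≡ g a
  at-a rewrite Ua = refl
  term≤0 : ∀ x → x ≢ a → (if U x then g x else 0ℚ) ≤ℚ 0ℚ
  term≤0 x x≢a with U x in Ux
  ... | true = others≤0 x Ux x≢a
  ... | false = ≤-refl

ΣIn-Σᶠ-comm : ∀ {m p} (U : Fin m → Bool) (h : Fin m → Fin p → ℚ) →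
              ΣIn U (λ x → Σᶠ (h x)) ≡ Σᶠ (λ y → ΣIn U (λ x → h x y))
ΣIn-Σᶠ-comm {p = p} U h =
  trans (Σᶠ-cong if-inside) (Σᶠ-comm (λ x y → if U x then h x y else 0ℚ))
  where
  if-inside : ∀ x → (if U x then Σᶠ (h x) else 0ℚ) ≡ Σᶠ (λ y → if U x then h x y else 0ℚ)
  if-inside x with U x
  ... | true = refl
  ... | false = sym (Σᶠ-zero {p})

*-card≤ΣIn : ∀ {m} {U : Fin m → Bool} {g : Fin m → ℚ} (q : ℚ) →
             (∀ x → U x ≡ true → q ≤ℚ g x) → q * card U ≤ℚ ΣIn U g
*-card≤ΣIn {m} {U} {g} q q≤g = begin
  q * card U                                  ≡⟨ Σᶠ-*ˡ {m} q (λ x → if U x then 1ℚ else 0ℚ) ⟨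
  Σᶠ (λ x → q * (if U x then 1ℚ else 0ℚ))     ≤⟨ Σᶠ-mono term≤ ⟩
  ΣIn U g                                     ∎
  where
  term≤ : ∀ x → q * (if U x then 1ℚ else 0ℚ) ≤ℚ (if U x then g x else 0ℚ)
  term≤ x with U x in Ux
  ... | true = ≤-trans (≤-reflexive (*-identityʳ q)) (q≤g x Ux)
  ... | false = ≤-reflexive (*-zeroʳ q)

ℕ→ℚ-*-mono : ∀ m {p q} → p ≤ℚ q → ℕ→ℚ m * p ≤ℚ ℕ→ℚ m * q
ℕ→ℚ-*-mono m = *-monoˡ-≤-nonNeg (ℕ→ℚ m) {{normalize-nonNeg m 1}}

3*p≡p+p+p : ∀ x → ℕ→ℚ 3 * x ≡ x + x + x
3*p≡p+p+p = solve 1 (λ x → con (ℕ→ℚ 3) :* x := x :+ x :+ x) refl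

p≤p+q : ∀ {p q} → 0ℚ ≤ℚ q → p ≤ℚ p + q
p≤p+q {p} 0≤q = ≤-trans (≤-reflexive (sym (+-identityʳ p))) (+-monoʳ-≤ p 0≤q)

p+[q-p]≡q : ∀ p q → p + (q - p) ≡ q
p+[q-p]≡q = solve 2 (λ p q → p :+ (q :- p) := q) refl

[p-q]⊔0+q≡p : ∀ {p q} → 0ℚ <ℚ (p - q) ⊔ 0ℚ → (p - q) ⊔ 0ℚ + q ≡ p
[p-q]⊔0+q≡p {p} {q} 0<⊔ with ≤-total (p - q) 0ℚ
... | inj₁ p-q≤0 = contradiction (subst (0ℚ <ℚ_) (p≤q⇒p⊔q≡q p-q≤0) 0<⊔) (<-irrefl refl)
... | inj₂ 0≤p-q = trans (cong (_+ q) (p≥q⇒p⊔q≡p 0≤p-q)) (solve 2 (λ p q → p :- q :+ q := p) refl p q)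

3*p+q≤3*r : ∀ {p q r} → 0ℚ ≤ℚ q → p + q ≤ℚ r → ℕ→ℚ 3 * p + q ≤ℚ ℕ→ℚ 3 * r
3*p+q≤3*r {p} {q} {r} 0≤q p+q≤r = begin
  ℕ→ℚ 3 * p + q              ≡⟨ cong (ℕ→ℚ 3 * p +_) (+-identityˡ q) ⟨
  ℕ→ℚ 3 * p + (0ℚ + q)        ≤⟨ +-monoʳ-≤ (ℕ→ℚ 3 * p) (+-monoˡ-≤ q (+-mono-≤ 0≤q 0≤q)) ⟩
  ℕ→ℚ 3 * p + (q + q + q)     ≡⟨ cong (ℕ→ℚ 3 * p +_) (3*p≡p+p+p q) ⟨
  ℕ→ℚ 3 * p + ℕ→ℚ 3 * q       ≡⟨ *-distribˡ-+ (ℕ→ℚ 3) p q ⟨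
  ℕ→ℚ 3 * (p + q)             ≤⟨ ℕ→ℚ-*-mono 3 p+q≤r ⟩
  ℕ→ℚ 3 * r                   ∎

fB-above : ∀ ℓ B {d} → B <ℚ ℕ→ℚ ℓ * d → fB ℓ B d ≡ d
fB-above ℓ B {d} B<ℓd = cong (if_then d else 0ℚ) (dec-true (B <? ℕ→ℚ ℓ * d) B<ℓd)

fB-below : ∀ ℓ B {d} → ¬ B <ℚ ℕ→ℚ ℓ * d → fB ℓ B d ≡ 0ℚ
fB-below ℓ B {d} B≮ℓd = cong (if_then d else 0ℚ) (dec-false (B <? ℕ→ℚ ℓ * d) B≮ℓd)

-- Case analysis on fB goes through this view (and helper functions elsewhere) rather than 'with':
-- with-abstraction over such goals makes Agda normalise ℕ→ℚ ℓ, a large gcd computation.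
data FBCase (ℓ : ℕ) (B d : ℚ) : Set where
  above : B <ℚ ℕ→ℚ ℓ * d → fB ℓ B d ≡ d → FBCase ℓ B d
  below : ℕ→ℚ ℓ * d ≤ℚ B → fB ℓ B d ≡ 0ℚ → FBCase ℓ B d

fB-case : ∀ ℓ B d → FBCase ℓ B d
fB-case ℓ B d = from-dec (B <? ℕ→ℚ ℓ * d)
  where
  from-dec : Dec (B <ℚ ℕ→ℚ ℓ * d) → FBCase ℓ B d
  from-dec (yes B<ℓd) = above B<ℓd (fB-above ℓ B B<ℓd)
  from-dec (no B≮ℓd) = below (≮⇒≥ B≮ℓd) (fB-below ℓ B B≮ℓd)

fB-nonneg : ∀ ℓ B {d} → 0ℚ ≤ℚ d → 0ℚ ≤ℚ fB ℓ B d
fB-nonneg ℓ B {d} 0≤d = case fB-case ℓ B d of λ where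
  (above _ fd≡d) → ≤-trans 0≤d (≤-reflexive (sym fd≡d))
  (below _ fd≡0) → ≤-reflexive (sym fd≡0)

fB-≤ : ∀ ℓ B {d x} → 0ℚ ≤ℚ x → d ≤ℚ x → fB ℓ B d ≤ℚ x
fB-≤ ℓ B {d} 0≤x d≤x = case fB-case ℓ B d of λ where
  (above _ fd≡d) → ≤-trans (≤-reflexive fd≡d) d≤x
  (below _ fd≡0) → ≤-trans (≤-reflexive fd≡0) 0≤x

fB-mono : ∀ ℓ B {d e} → 0ℚ ≤ℚ e → d ≤ℚ e → fB ℓ B d ≤ℚ fB ℓ B e
fB-mono ℓ B {d} {e} 0≤e d≤e = case fB-case ℓ B d of λ where
  (below _ fd≡0) → ≤-trans (≤-reflexive fd≡0) (fB-nonneg ℓ B 0≤e)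
  (above B<ℓd fd≡d) → begin
    fB ℓ B d ≡⟨ fd≡d ⟩
    d        ≤⟨ d≤e ⟩
    e        ≡⟨ fB-above ℓ B (<-≤-trans B<ℓd (ℕ→ℚ-*-mono ℓ d≤e)) ⟨
    fB ℓ B e ∎

fB-≤-cases : ∀ ℓ B {d a} → fB ℓ B d ≤ℚ a → d ≤ℚ a ⊎ ℕ→ℚ ℓ * d ≤ℚ B
fB-≤-cases ℓ B {d} fd≤a = case fB-case ℓ B d of λ where
  (above _ fd≡d) → inj₁ (≤-trans (≤-reflexive (sym fd≡d)) fd≤a)
  (below ℓd≤B _) → inj₂ ℓd≤B

-- Either ℓ a ≤ B, and then every dₖ has ℓ dₖ ≤ B, so ℓ d ≤ 3B and f_{3B}(d) = 0;
-- or B < ℓ a, and then every dₖ ≤ a, so d ≤ 3a.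
fB-triple : ∀ ℓ B {a d d₁ d₂ d₃} → 0ℚ ≤ℚ a →
            fB ℓ B d₁ ≤ℚ a → fB ℓ B d₂ ≤ℚ a → fB ℓ B d₃ ≤ℚ a → d ≤ℚ d₁ + d₂ + d₃ →
            fB ℓ (ℕ→ℚ 3 * B) d ≤ℚ ℕ→ℚ 3 * a
fB-triple ℓ B {a} {d} {d₁} {d₂} {d₃} 0≤a f₁ f₂ f₃ d≤Σ = by-cases (ℕ→ℚ ℓ * a ≤? B)
  where
  0≤3a : 0ℚ ≤ℚ ℕ→ℚ 3 * a
  0≤3a = ≤-trans (≤-reflexive (sym (*-zeroʳ (ℕ→ℚ 3)))) (ℕ→ℚ-*-mono 3 0≤a)

  bounded-by-B : ℕ→ℚ ℓ * a ≤ℚ B → ∀ {dₖ} → fB ℓ B dₖ ≤ℚ a → ℕ→ℚ ℓ * dₖ ≤ℚ B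
  bounded-by-B ℓa≤B fₖ = [ (λ dₖ≤a → ≤-trans (ℕ→ℚ-*-mono ℓ dₖ≤a) ℓa≤B) , id ]′ (fB-≤-cases ℓ B fₖ)

  bounded-by-a : B <ℚ ℕ→ℚ ℓ * a → ∀ {dₖ} → fB ℓ B dₖ ≤ℚ a → dₖ ≤ℚ a
  bounded-by-a B<ℓa fₖ =
    [ id , (λ ℓdₖ≤B → <⇒≤ (*-cancelˡ-<-nonNeg (ℕ→ℚ ℓ) {{normalize-nonNeg ℓ 1}} (≤-<-trans ℓdₖ≤B B<ℓa))) ]′
      (fB-≤-cases ℓ B fₖ)

  by-cases : Dec (ℕ→ℚ ℓ * a ≤ℚ B) → fB ℓ (ℕ→ℚ 3 * B) d ≤ℚ ℕ→ℚ 3 * a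
  by-cases (yes ℓa≤B) =
    ≤-trans (≤-reflexive (fB-below ℓ (ℕ→ℚ 3 * B) (λ 3B<ℓd → <-irrefl refl (<-≤-trans 3B<ℓd ℓd≤3B)))) 0≤3a
    where
    bound = bounded-by-B ℓa≤B
    ℓd≤3B : ℕ→ℚ ℓ * d ≤ℚ ℕ→ℚ 3 * B
    ℓd≤3B = begin
      ℕ→ℚ ℓ * d                               ≤⟨ ℕ→ℚ-*-mono ℓ d≤Σ ⟩
      ℕ→ℚ ℓ * (d₁ + d₂ + d₃)                   ≡⟨ *-distribˡ-+ (ℕ→ℚ ℓ) (d₁ + d₂) d₃ ⟩
      ℕ→ℚ ℓ * (d₁ + d₂) + ℕ→ℚ ℓ * d₃           ≡⟨ cong (_+ ℕ→ℚ ℓ * d₃) (*-distribˡ-+ (ℕ→ℚ ℓ) d₁ d₂) ⟩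
      ℕ→ℚ ℓ * d₁ + ℕ→ℚ ℓ * d₂ + ℕ→ℚ ℓ * d₃     ≤⟨ +-mono-≤ (+-mono-≤ (bound f₁) (bound f₂)) (bound f₃) ⟩
      B + B + B                                ≡⟨ 3*p≡p+p+p B ⟨
      ℕ→ℚ 3 * B                                ∎
  by-cases (no ℓa≰B) = fB-≤ ℓ (ℕ→ℚ 3 * B) 0≤3a (begin
    d                 ≤⟨ d≤Σ ⟩
    d₁ + d₂ + d₃      ≤⟨ +-mono-≤ (+-mono-≤ (bound f₁) (bound f₂)) (bound f₃) ⟩
    a + a + a         ≡⟨ 3*p≡p+p+p a ⟨
    ℕ→ℚ 3 * a         ∎)
    where bound = bounded-by-a (≰⇒> ℓa≰B)

module AlgorithmProperties {n : ℕ} (c : Fin n → Fin n → ℚ) (ℓ : ℕ) (B̄ λ' : ℚ) where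
  open Algorithm c ℓ B̄ λ'

  α-raise-active : ∀ s t {j} → active s j ≡ true → α (raise s t) j ≡ α s j + t
  α-raise-active s t {j} act = cong (if_then α s j + t else α s j) act

  α-raise-frozen : ∀ s t {j} → active s j ≡ false → α (raise s t) j ≡ α s j
  α-raise-frozen s t {j} frz = cong (if_then α s j + t else α s j) frz

  α-raise-≥ : ∀ s {t} j → 0ℚ ≤ℚ t → α s j ≤ℚ α (raise s t) j
  α-raise-≥ s {t} j 0≤t = for-status (active s j)
    where
    for-status : ∀ b → α s j ≤ℚ (if b then α s j + t else α s j)
    for-status true = p≤p+q 0≤t
    for-status false = ≤-refl

  α-raise-≤ : ∀ s {t} j → 0ℚ ≤ℚ t → α (raise s t) j ≤ℚ α s j + t
  α-raise-≤ s {t} j 0≤t = for-status (active s j)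
    where
    for-status : ∀ b → (if b then α s j + t else α s j) ≤ℚ α s j + t
    for-status true = ≤-refl
    for-status false = p≤p+q 0≤t

  grown : State n → ℚ → Fin n → Fin n → ℚ
  grown s t i j = β s i j + (pos (α (raise s t) j - f (c i j)) - pos (α s j - f (c i j)))

  β-raise-opened : ∀ s t {i j} → inF s i ≡ true → β (raise s t) i j ≡ β s i j
  β-raise-opened s t {i} {j} opn = cong (λ o → if not o ∧ active s j then grown s t i j else β s i j) opn

  β-raise-frozen : ∀ s t {i j} → active s j ≡ false → β (raise s t) i j ≡ β s i j
  β-raise-frozen s t {i} {j} frz =
    cong (if_then grown s t i j else β s i j) (trans (cong (not (inF s i) ∧_) frz) (∧-zeroʳ (not (inF s i))))

  β-raise-unopened : ∀ s t {i j} → inF s i ≡ false → active s j ≡ true → β (raise s t) i j ≡ grown s t i j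
  β-raise-unopened s t {i} {j} unopn act =
    cong₂ (λ o b → if not o ∧ b then grown s t i j else β s i j) unopn act

  β-raise-cases : ∀ s t i j →
    (inF s i ≡ false × active s j ≡ true) ⊎ β (raise s t) i j ≡ β s i j
  β-raise-cases s t i j = for-status (inF s i ≟ᵇ true) (active s j ≟ᵇ true)
    where
    for-status : Dec (inF s i ≡ true) → Dec (active s j ≡ true) →
                 (inF s i ≡ false × active s j ≡ true) ⊎ β (raise s t) i j ≡ β s i j
    for-status (yes opn) _ = inj₂ (β-raise-opened s t opn)
    for-status (no ¬opn) (yes act) = inj₁ (¬-not ¬opn , act)
    for-status (no _) (no ¬act) = inj₂ (β-raise-frozen s t (¬-not ¬act))

  opened-handle-⊇ : ∀ r {i} → inF r i ≡ true → inF (handle r) i ≡ true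
  opened-handle-⊇ r {i} opn = cong (λ o → o ∨ (not o ∧ does (λ' ≤? Σᶠ (β r i)))) opn

  opened-handle : ∀ r {i} → inF (handle r) i ≡ true → inF r i ≡ true ⊎ λ' ≤ℚ Σᶠ (β r i)
  opened-handle r {i} = for-status (inF r i)
    where
    for-status : ∀ o → o ∨ (not o ∧ does (λ' ≤? Σᶠ (β r i))) ≡ true → o ≡ true ⊎ λ' ≤ℚ Σᶠ (β r i)
    for-status true _ = inj₁ refl
    for-status false paid = inj₂ (does-true (λ' ≤? Σᶠ (β r i)) paid)

  unopened-handle : ∀ r {i} → inF (handle r) i ≡ false → inF r i ≡ false
  unopened-handle r {i} unopn = ¬-not (λ opn → contradiction (trans (sym (opened-handle-⊇ r opn)) unopn) λ ())

  active-handle : ∀ r {j} → active (handle r) j ≡ true → active r j ≡ true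
  active-handle r act = proj₁ (∧-true act)

  active-handle-unreached : ∀ r {j i} → active (handle r) j ≡ true → inF (handle r) i ≡ true →
                            reaches r j i ≡ false
  active-handle-unreached r {j} {i} act opn = ¬-not unreached
    where
    unreached : reaches r j i ≢ true
    unreached rch = contradiction (trans (sym reached) (∧-not-true act)) λ ()
      where
      reached : anyᶠ (λ i → inF (handle r) i ∧ reaches r j i) ≡ true
      reached = anyᶠ-intro (λ i → inF (handle r) i ∧ reaches r j i) i (cong₂ _∧_ opn rch)

  frozen-by-handle : ∀ r {j} → active r j ≡ true → active (handle r) j ≡ false →
                     ∃[ i ] (inF (handle r) i ≡ true × reaches r j i ≡ true)
  frozen-by-handle r {j} act frz =
    map₂ ∧-true (anyᶠ-witness (λ i → inF (handle r) i ∧ reaches r j i) (∧-not-false act frz))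

  Conflict : State n → (Fin n → Bool) → Fin n → Set
  Conflict s T i = ∃₂ λ j i' → T i' ≡ true × 0ℚ <ℚ β s i j × 0ℚ <ℚ β s i' j

  conflict? : ∀ s T i → Dec (Conflict s T i)
  conflict? s T i = any? λ j → any? λ i' →
    (T i' ≟ᵇ true) ×-dec (0ℚ <? β s i j) ×-dec (0ℚ <? β s i' j)

  pruned-maximal : ∀ s T {i} → Pruned s T → inF s i ≡ true → T i ≡ true ⊎ Conflict s T i
  pruned-maximal s T {i} (T⊆F , T-free , T-maximal) opn with conflict? s T i
  ... | yes conflict = inj₂ conflict
  ... | no no-conflict = inj₁ (T-maximal T+i (λ x Tx → cong (_∨ does (x ≟ᶠ i)) Tx) T+i⊆F T+i-free i added)
    where
    T+i : Fin n → Bool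
    T+i x = T x ∨ does (x ≟ᶠ i)

    added : T+i i ≡ true
    added = trans (cong (T i ∨_) (dec-true (i ≟ᶠ i) refl)) (∨-zeroʳ (T i))

    member : ∀ {x} → T+i x ≡ true → T x ≡ true ⊎ x ≡ i
    member {x} x∈ with ∨-true {T x} x∈
    ... | inj₁ Tx = inj₁ Tx
    ... | inj₂ x≡i = inj₂ (does-true (x ≟ᶠ i) x≡i)

    T+i⊆F : T+i ⊆ inF s
    T+i⊆F x x∈ with member x∈
    ... | inj₁ Tx = T⊆F x Tx
    ... | inj₂ refl = opn

    T+i-free : Conflictfree s T+i
    T+i-free j x y x∈ y∈ βx>0 βy>0 with member x∈ | member y∈
    ... | inj₁ Tx | inj₁ Ty = T-free j x y Tx Ty βx>0 βy>0
    ... | inj₁ Tx | inj₂ refl = contradiction (j , x , Tx , βy>0 , βx>0) no-conflict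
    ... | inj₂ refl | inj₁ Ty = contradiction (j , y , Ty , βx>0 , βy>0) no-conflict
    ... | inj₂ refl | inj₂ refl = refl

module DualAscentInvariant {n : ℕ} (c : Fin n → Fin n → ℚ) (ℓ : ℕ) (B̄ λ' : ℚ)
                           (c-nonneg : ∀ i j → 0ℚ ≤ℚ c i j) where
  open Algorithm c ℓ B̄ λ'
  open AlgorithmProperties c ℓ B̄ λ'

  f-nonneg : ∀ i j → 0ℚ ≤ℚ f (c i j)
  f-nonneg i j = fB-nonneg ℓ B̄ (c-nonneg i j)

  FrozenBy : State n → Fin n → Fin n → Set
  FrozenBy s j i = inF s i ≡ true × f (c i j) ≤ℚ α s j × (∀ j' → 0ℚ <ℚ β s i j' → α s j' ≤ℚ α s j)

  record Invariant (s : State n) : Set where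
    field
      α-nonneg         : ∀ j → 0ℚ ≤ℚ α s j
      β-nonneg         : ∀ i j → 0ℚ ≤ℚ β s i j
      β-unopened       : ∀ {i j} → inF s i ≡ false → active s j ≡ true →
                         β s i j ≡ pos (α s j - f (c i j))
      β-tight          : ∀ {i j} → 0ℚ <ℚ β s i j → β s i j + f (c i j) ≤ℚ α s j
      active-maximal   : ∀ {j} → active s j ≡ true → ∀ j' → α s j' ≤ℚ α s j
      active-unreached : ∀ {i j} → active s j ≡ true → inF s i ≡ true → α s j <ℚ f (c i j)
      opened-paid      : ∀ {i} → inF s i ≡ true → λ' ≤ℚ Σᶠ (β s i)
      frozen-witness   : ∀ {j} → active s j ≡ false → ∃ (FrozenBy s j)

    paying-reached : ∀ {i j} → 0ℚ <ℚ β s i j → f (c i j) ≤ℚ α s j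
    paying-reached {i} {j} β>0 = ≤-trans (≤-trans (≤-reflexive (sym (+-identityˡ (f (c i j)))))
                                                   (+-monoˡ-≤ (f (c i j)) (β-nonneg i j)))
                                         (β-tight β>0)

    paid-by-opened-frozen : ∀ {i j} → inF s i ≡ true → 0ℚ <ℚ β s i j → active s j ≡ false
    paid-by-opened-frozen {i} {j} opn β>0 = ¬-not λ act →
      <-irrefl refl (<-≤-trans (active-unreached act opn) (paying-reached β>0))

  open Invariant

  invariant-initial : Invariant initial
  invariant-initial = record
    { α-nonneg         = λ _ → ≤-refl
    ; β-nonneg         = λ _ _ → ≤-refl
    ; β-unopened       = λ {i} {j} _ _ → sym (p≤q⇒p⊔q≡q (-f≤0 i j))
    ; β-tight          = λ 0<0 → contradiction 0<0 (<-irrefl refl)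
    ; active-maximal   = λ _ _ → ≤-refl
    ; active-unreached = λ _ ()
    ; opened-paid      = λ ()
    ; frozen-witness   = λ ()
    }
    where
    -f≤0 : ∀ i j → 0ℚ - f (c i j) ≤ℚ 0ℚ
    -f≤0 i j = ≤-trans (≤-reflexive (+-identityˡ (- f (c i j)))) (neg-antimono-≤ (f-nonneg i j))

  module Phase {s : State n} (inv : Invariant s) {δ : ℚ} (0≤δ : 0ℚ ≤ℚ δ) where
    r : State n
    r = raise s δ

    s′ : State n
    s′ = handle r

    β-unopened-raised : ∀ {i j} → inF s i ≡ false → active s j ≡ true →
                        β r i j ≡ pos (α r j - f (c i j))
    β-unopened-raised {i} {j} unopn act = begin-equality
      β r i j                                          ≡⟨ β-raise-unopened s δ unopn act ⟩
      β s i j + (pos (α r j - f (c i j)) - old)        ≡⟨ cong (λ b → b + (pos (α r j - f (c i j)) - old))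
                                                              (β-unopened inv unopn act) ⟩
      old + (pos (α r j - f (c i j)) - old)            ≡⟨ p+[q-p]≡q old (pos (α r j - f (c i j))) ⟩
      pos (α r j - f (c i j))                          ∎
      where old = pos (α s j - f (c i j))

    raised-maximal : ∀ {j} → active s j ≡ true → ∀ j' → α r j' ≤ℚ α r j
    raised-maximal {j} act j' = begin
      α r j'     ≤⟨ α-raise-≤ s j' 0≤δ ⟩
      α s j' + δ ≤⟨ +-monoˡ-≤ δ (active-maximal inv act j') ⟩
      α s j + δ  ≡⟨ α-raise-active s δ act ⟨
      α r j      ∎

    α-nonneg′ : ∀ j → 0ℚ ≤ℚ α s′ j
    α-nonneg′ j = ≤-trans (α-nonneg inv j) (α-raise-≥ s j 0≤δ)

    β-nonneg′ : ∀ i j → 0ℚ ≤ℚ β s′ i j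
    β-nonneg′ i j = case β-raise-cases s δ i j of λ where
      (inj₁ (unopn , act)) → ≤-trans (p≤q⊔p (α r j - f (c i j)) 0ℚ)
                                     (≤-reflexive (sym (β-unopened-raised unopn act)))
      (inj₂ unchanged)     → ≤-trans (β-nonneg inv i j) (≤-reflexive (sym unchanged))

    β-unopened′ : ∀ {i j} → inF s′ i ≡ false → active s′ j ≡ true →
                  β s′ i j ≡ pos (α s′ j - f (c i j))
    β-unopened′ unopn act = β-unopened-raised (unopened-handle r unopn) (active-handle r act)

    positive-part-tight : ∀ {i j} → 0ℚ <ℚ β r i j → β r i j ≡ pos (α r j - f (c i j)) →
                          β r i j + f (c i j) ≡ α r j
    positive-part-tight {i} {j} β>0 raised =
      trans (cong (_+ f (c i j)) raised) ([p-q]⊔0+q≡p (subst (0ℚ <ℚ_) raised β>0))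

    β-tight′ : ∀ {i j} → 0ℚ <ℚ β s′ i j → β s′ i j + f (c i j) ≤ℚ α s′ j
    β-tight′ {i} {j} β>0 = case β-raise-cases s δ i j of λ where
      (inj₁ (unopn , act)) → ≤-reflexive (positive-part-tight β>0 (β-unopened-raised unopn act))
      (inj₂ unchanged)     → begin
        β r i j + f (c i j) ≡⟨ cong (_+ f (c i j)) unchanged ⟩
        β s i j + f (c i j) ≤⟨ β-tight inv (subst (0ℚ <ℚ_) unchanged β>0) ⟩
        α s j               ≤⟨ α-raise-≥ s j 0≤δ ⟩
        α r j               ∎

    active-maximal′ : ∀ {j} → active s′ j ≡ true → ∀ j' → α s′ j' ≤ℚ α s′ j
    active-maximal′ act = raised-maximal (active-handle r act)

    active-unreached′ : ∀ {i j} → active s′ j ≡ true → inF s′ i ≡ true → α s′ j <ℚ f (c i j)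
    active-unreached′ {i} {j} act opn =
      ≰⇒> (does-false (f (c i j) ≤? α r j) (active-handle-unreached r act opn))

    opened-paid′ : ∀ {i} → inF s′ i ≡ true → λ' ≤ℚ Σᶠ (β s′ i)
    opened-paid′ {i} opn = case opened-handle r opn of λ where
      (inj₁ opn-before) → ≤-trans (opened-paid inv opn-before)
                                  (≤-reflexive (Σᶠ-cong (λ j → sym (β-raise-opened s δ {i} {j} opn-before))))
      (inj₂ paid-now)   → paid-now

    frozen-witness′ : ∀ {j} → active s′ j ≡ false → ∃ (FrozenBy s′ j)
    frozen-witness′ {j} frz = by-status (active s j ≟ᵇ true)
      where
      newly-frozen : ∀ {i} → active s j ≡ true → inF s′ i ≡ true × reaches r j i ≡ true →
                     FrozenBy s′ j i
      newly-frozen {i} act (opn , rch) =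
        opn , does-true (f (c i j) ≤? α r j) rch , λ j' _ → raised-maximal act j'

      still-frozen : ∀ {i} → active s j ≡ false → FrozenBy s j i → FrozenBy s′ j i
      still-frozen {i} frz-before (opn , f≤α , dominated) =
        opened-handle-⊇ r opn , ≤-trans f≤α (≤-reflexive (sym (α-raise-frozen s δ frz-before))) ,
        still-dominated
        where
        still-dominated : ∀ j' → 0ℚ <ℚ β r i j' → α r j' ≤ℚ α r j
        still-dominated j' β>0 = begin
          α r j'  ≡⟨ α-raise-frozen s δ (paid-by-opened-frozen inv opn β-before>0) ⟩
          α s j'  ≤⟨ dominated j' β-before>0 ⟩
          α s j   ≡⟨ α-raise-frozen s δ frz-before ⟨
          α r j   ∎
          where β-before>0 = subst (0ℚ <ℚ_) (β-raise-opened s δ opn) β>0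

      by-status : Dec (active s j ≡ true) → ∃ (FrozenBy s′ j)
      by-status (yes act) = map₂ (newly-frozen act) (frozen-by-handle r act frz)
      by-status (no ¬act) = map₂ (still-frozen (¬-not ¬act)) (frozen-witness inv (¬-not ¬act))

    invariant-handle-raise : Invariant s′
    invariant-handle-raise = record
      { α-nonneg         = α-nonneg′
      ; β-nonneg         = β-nonneg′
      ; β-unopened       = β-unopened′
      ; β-tight          = β-tight′
      ; active-maximal   = active-maximal′
      ; active-unreached = active-unreached′
      ; opened-paid      = opened-paid′
      ; frozen-witness   = frozen-witness′
      }

  invariant-step : ∀ {s s′} → Invariant s → Step s s′ → Invariant s′
  invariant-step inv (_ , _ , 0≤δ , _ , _ , refl) = Phase.invariant-handle-raise inv 0≤δ

  invariant-run : ∀ {s} → Star Step initial s → Invariant s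
  invariant-run = go invariant-initial
    where
    go : ∀ {s s′} → Invariant s → Star Step s s′ → Invariant s′
    go inv ε = inv
    go inv (step ◅ steps) = go (invariant-step inv step) steps

module Accounting {n : ℕ} (c : Fin n → Fin n → ℚ) (metric : IsMetric c) (k ℓ : ℕ) (B̄ λ' : ℚ)
                  {s : State n} (ascent : Algorithm.DualAscent c ℓ B̄ λ' s)
                  {T : Fin n → Bool} (pruned : Algorithm.Pruned c ℓ B̄ λ' s T)
                  {a : Fin n → Fin n} (nearest : NearestAssignment c k ℓ T a) where
  open Algorithm c ℓ B̄ λ'
  open AlgorithmProperties c ℓ B̄ λ'
  open IsMetric metric
  open DualAscentInvariant c ℓ B̄ λ' nonneg
  open Invariant (invariant-run (proj₁ ascent))

  paid : Fin n → ℚ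
  paid j = ΣIn T (λ i → β s i j)

  cost : Fin n → ℚ
  cost j = if inS s T j then fB ℓ B̄ (c (a j) j) else fB ℓ (ℕ→ℚ 3 * B̄) (c (a j) j)

  nearest-≤ : ∀ {i} j → T i ≡ true → c (a j) j ≤ℚ c i j
  nearest-≤ j Ti = proj₂ (nearest j) _ Ti

  in-S-bound : ∀ {i j} → T i ≡ true → 0ℚ <ℚ β s i j →
               ℕ→ℚ 3 * paid j + fB ℓ B̄ (c (a j) j) ≤ℚ ℕ→ℚ 3 * α s j
  in-S-bound {i} {j} Ti β>0 = begin
    ℕ→ℚ 3 * paid j + f (c (a j) j)  ≤⟨ +-mono-≤ (ℕ→ℚ-*-mono 3 paid≤β) (fB-mono ℓ B̄ (nonneg i j) (nearest-≤ j Ti)) ⟩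
    ℕ→ℚ 3 * β s i j + f (c i j)     ≤⟨ 3*p+q≤3*r {p = β s i j} (f-nonneg i j) (β-tight β>0) ⟩
    ℕ→ℚ 3 * α s j                   ∎
    where
    paid≤β : paid j ≤ℚ β s i j
    paid≤β = ΣIn-≤-single Ti (λ x Tx x≢i → ≮⇒≥ (λ βx>0 → x≢i (proj₁ (proj₂ pruned) j x i Tx Ti βx>0 β>0)))

  detour-bound : ∀ {j i₀ i' j'} → T i' ≡ true →
                 f (c i' j') ≤ℚ α s j → f (c i₀ j') ≤ℚ α s j → f (c i₀ j) ≤ℚ α s j →
                 fB ℓ (ℕ→ℚ 3 * B̄) (c (a j) j) ≤ℚ ℕ→ℚ 3 * α s j
  detour-bound {j} {i₀} {i'} {j'} Ti' f₁ f₂ f₃ = fB-triple ℓ B̄ (α-nonneg j) f₁ f₂ f₃ (begin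
    c (a j) j                      ≤⟨ nearest-≤ j Ti' ⟩
    c i' j                         ≤⟨ tri i' j' j ⟩
    c i' j' + c j' j               ≤⟨ +-monoʳ-≤ (c i' j') (tri j' i₀ j) ⟩
    c i' j' + (c j' i₀ + c i₀ j)    ≡⟨ cong (λ x → c i' j' + (x + c i₀ j)) (symm j' i₀) ⟩
    c i' j' + (c i₀ j' + c i₀ j)    ≡⟨ +-assoc (c i' j') (c i₀ j') (c i₀ j) ⟨
    c i' j' + c i₀ j' + c i₀ j      ∎)

  service-bound-3B̄ : ∀ j → fB ℓ (ℕ→ℚ 3 * B̄) (c (a j) j) ≤ℚ ℕ→ℚ 3 * α s j
  service-bound-3B̄ j = via-witness (frozen-witness (proj₂ ascent j))
    where
    via-witness : ∃ (FrozenBy s j) → fB ℓ (ℕ→ℚ 3 * B̄) (c (a j) j) ≤ℚ ℕ→ℚ 3 * α s j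
    via-witness (i₀ , opn , f≤α , dominated) = via-pruning (pruned-maximal s T pruned opn)
      where
      via-pruning : T i₀ ≡ true ⊎ Conflict s T i₀ → fB ℓ (ℕ→ℚ 3 * B̄) (c (a j) j) ≤ℚ ℕ→ℚ 3 * α s j
      via-pruning (inj₁ Ti₀) = detour-bound Ti₀ f≤α f≤α f≤α
      via-pruning (inj₂ (j' , i' , Ti' , β₀>0 , β'>0)) =
        detour-bound Ti' (≤-trans (paying-reached β'>0) (dominated j' β₀>0))
                         (≤-trans (paying-reached β₀>0) (dominated j' β₀>0)) f≤α

  outside-S-bound : ∀ {j} → inS s T j ≡ false →
                    ℕ→ℚ 3 * paid j + fB ℓ (ℕ→ℚ 3 * B̄) (c (a j) j) ≤ℚ ℕ→ℚ 3 * α s j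
  outside-S-bound {j} j∉S = begin
    ℕ→ℚ 3 * paid j + fB ℓ (ℕ→ℚ 3 * B̄) (c (a j) j) ≤⟨ +-mono-≤ (ℕ→ℚ-*-mono 3 paid≤0) (service-bound-3B̄ j) ⟩
    ℕ→ℚ 3 * 0ℚ + ℕ→ℚ 3 * α s j                     ≡⟨ cong (_+ ℕ→ℚ 3 * α s j) (*-zeroʳ (ℕ→ℚ 3)) ⟩
    0ℚ + ℕ→ℚ 3 * α s j                             ≡⟨ +-identityˡ (ℕ→ℚ 3 * α s j) ⟩
    ℕ→ℚ 3 * α s j                                  ∎
    where
    paid≤0 : paid j ≤ℚ 0ℚ
    paid≤0 = ΣIn-nonpos λ x Tx → ≮⇒≥ λ βx>0 →
      contradiction (trans (sym (anyᶠ-intro _ x (cong₂ _∧_ Tx (dec-true (0ℚ <? β s x j) βx>0)))) j∉S) λ ()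

  client-bound : ∀ j → ℕ→ℚ 3 * paid j + cost j ≤ℚ ℕ→ℚ 3 * α s j
  client-bound j = for-membership (inS s T j) refl
    where
    for-membership : ∀ b → inS s T j ≡ b →
                     ℕ→ℚ 3 * paid j + (if b then fB ℓ B̄ (c (a j) j) else fB ℓ (ℕ→ℚ 3 * B̄) (c (a j) j))
                       ≤ℚ ℕ→ℚ 3 * α s j
    for-membership false j∉S = outside-S-bound j∉S
    for-membership true j∈S =
      let i , Ti∧β>0 = anyᶠ-witness (λ i → T i ∧ does (0ℚ <? β s i j)) j∈S
          Ti , β>0 = ∧-true Ti∧β>0
      in in-S-bound Ti (does-true (0ℚ <? β s i j) β>0)

  total-bound : ℕ→ℚ 3 * λ' * card T + Σᶠ cost ≤ℚ ℕ→ℚ 3 * Σᶠ (λ j → α s j)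
  total-bound = begin
    ℕ→ℚ 3 * λ' * card T + Σᶠ cost                 ≡⟨ cong (_+ Σᶠ cost) (*-assoc (ℕ→ℚ 3) λ' (card T)) ⟩
    ℕ→ℚ 3 * (λ' * card T) + Σᶠ cost               ≤⟨ +-monoˡ-≤ (Σᶠ cost) (ℕ→ℚ-*-mono 3 opening≤paid) ⟩
    ℕ→ℚ 3 * Σᶠ paid + Σᶠ cost                     ≡⟨ cong (_+ Σᶠ cost) (Σᶠ-*ˡ (ℕ→ℚ 3) paid) ⟨
    Σᶠ (λ j → ℕ→ℚ 3 * paid j) + Σᶠ cost           ≡⟨ Σᶠ-+ (λ j → ℕ→ℚ 3 * paid j) cost ⟨
    Σᶠ (λ j → ℕ→ℚ 3 * paid j + cost j)            ≤⟨ Σᶠ-mono client-bound ⟩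
    Σᶠ (λ j → ℕ→ℚ 3 * α s j)                      ≡⟨ Σᶠ-*ˡ (ℕ→ℚ 3) (α s) ⟩
    ℕ→ℚ 3 * Σᶠ (λ j → α s j)                      ∎
    where
    opening≤paid : λ' * card T ≤ℚ Σᶠ paid
    opening≤paid = ≤-trans (*-card≤ΣIn λ' (λ i Ti → opened-paid (proj₁ pruned i Ti)))
                           (≤-reflexive (ΣIn-Σᶠ-comm T (β s)))

theorem3 : (n k ℓ : ℕ) (c : Fin n → Fin n → ℚ) → IsMetric c → k < n → 1 ≤ ℓ → ℓ ≤ n →
    (ε B̄ : ℚ) → 0ℚ <ℚ ε → OPT≤ c k ℓ B̄ B̄ → BoundedByOpt c k ℓ ε B̄ →
    (λ' : ℚ) → 0ℚ ≤ℚ λ' →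
    (s : State n) → Algorithm.DualAscent c ℓ B̄ λ' s →
    (T : Fin n → Bool) → Algorithm.Pruned c ℓ B̄ λ' s T →
    (i : Fin n → Fin n) → NearestAssignment c k ℓ T i →
    ℕ→ℚ 3 * λ' * card T
      + Σᶠ (λ j → if Algorithm.inS c ℓ B̄ λ' s T j
                  then fB ℓ B̄ (c (i j) j)
                  else fB ℓ (ℕ→ℚ 3 * B̄) (c (i j) j))
      ≤ℚ ℕ→ℚ 3 * Σᶠ (λ j → α s j)
theorem3 n k ℓ c metric _ _ _ _ B̄ _ _ _ λ' _ s ascent T pruned i nearest =
  Accounting.total-bound c metric k ℓ B̄ λ' ascent pruned nearest
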